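{- Let $(s(n))_{n\geq 1}$ be the integer sequence defined by $s(1)=0$, $s(2)=1$, $s(3)=1$ and, for all $k\geq 1$, \[ s(4k) = 2s(2k) - s(k),\quad s(4k+1) = 2s(2k) + s(2k+1),\quad s(4k+2) = 2s(2k+1) + s(2k),\quad s(4k+3) = 2s(2k+1) - s(k). \] Then, as formal power series in $x$, \[ \sum_{m\geq 0} \tau(m^2+1)\,x^m = \sum_{n\geq 1} x^{s(n)}, \] where $\tau$ denotes the number-of-divisors function. Equivalently, for every integer $m\geq 0$, $\#\{n\geq 1 : s(n)=m\} = \tau(m^2+1)$.
   Context: $\tau(N)$ is the number of positive divisors of the positive integer $N$. -}

module Defs where

open import Data.Nat using (ℕ; suc; _+_; _*_; _≤_)
open import Data.Nat.Divisibility using (_∣?_)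
open import Data.Integer using (ℤ; +_; -_) renaming (_+_ to _+ℤ_; _*_ to _*ℤ_)
open import Data.List using (List; length; filter; map; upTo)
open import Relation.Binary.PropositionalEquality using (_≡_)

range1 : ℕ → List ℕ
range1 B = map suc (upTo B)

-- τ(N) = number of positive divisors of N (for N ≥ 1 all divisors lie in 1..N)
τ : ℕ → ℕ
τ N = length (filter (_∣? N) (range1 N))

-- s : ℕ → ℤ satisfies the defining recursion of the paper's sequence (on n ≥ 1;
-- the value at 0 is irrelevant and unconstrained).
record IsS (s : ℕ → ℤ) : Set where
  field
    s1 : s 1 ≡ + 0
    s2 : s 2 ≡ + 1
    s3 : s 3 ≡ + 1
    s4k   : ∀ k → 1 ≤ k → s (4 * k)     ≡ (+ 2) *ℤ s (2 * k) +ℤ (- s k)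
    s4k+1 : ∀ k → 1 ≤ k → s (4 * k + 1) ≡ (+ 2) *ℤ s (2 * k) +ℤ s (2 * k + 1)
    s4k+2 : ∀ k → 1 ≤ k → s (4 * k + 2) ≡ (+ 2) *ℤ s (2 * k + 1) +ℤ s (2 * k)
    s4k+3 : ∀ k → 1 ≤ k → s (4 * k + 3) ≡ (+ 2) *ℤ s (2 * k + 1) +ℤ (- s k)

module Submission where

-- Write ⟨ a , x , b ⟩ for a symmetric matrix [[a, x], [x, b]] with positive entries and determinant 1.
-- Every such matrix other than the identity has exactly one parent under M ↦ E M Eᵀ, M ↦ Eᵀ M E
-- (E = [[1, 0], [1, 1]]): subtract the smaller diagonal entry from the off-diagonal one. Hence these
-- matrices form a binary tree rooted at the identity, and numbering its nodes in binary, the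
-- recurrences for s say exactly that s(n) is the off-diagonal entry of node n. The nodes with s(n) = m
-- are then the matrices [[a, m], [m, (m² + 1)/a]], one for each divisor a of m² + 1; as the
-- off-diagonal entry grows along every edge, they all lie within depth m, i.e. below n = 2^(m+1).

open import Defs
open import Data.Nat using (ℕ; _+_; _*_; _≤_)
open import Data.Integer using (ℤ; +_)
import Data.Integer as ℤ
open import Data.List using (length; filter)
open import Data.Product using (∃-syntax; _×_)
open import Relation.Binary.PropositionalEquality using (_≡_)

open import Data.Nat using (zero; suc; pred; >-nonZero; _∸_; _^_; _<_; z≤n; s≤s; _≤?_; _≟_)
open import Data.Nat.Properties
open import Data.Nat.Divisibility using (_∣_; divides; _∣?_)
open import Data.Nat.DivMod using (_/_; m*n/n≡m)
open import Data.Nat.Tactic.RingSolver using (solve-∀)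
import Data.Integer.Properties as ℤ
open import Data.Bool using (Bool; true; false)
open import Data.List using (List; []; _∷_; map; upTo)
open import Data.List.Properties using (length-map; map-∘; map-id-local)
open import Data.List.Membership.Propositional using (_∈_)
open import Data.List.Membership.Propositional.Properties using (∈-map⁺; ∈-map⁻; ∈-upTo⁺; ∈-filter⁺; ∈-filter⁻)
open import Data.List.Membership.Propositional.Properties.WithK using (unique∧set⇒bag)
open import Data.List.Relation.Binary.BagAndSetEquality using (∼bag⇒↭)
open import Data.List.Relation.Binary.Permutation.Propositional.Properties using (↭-length)
open import Data.List.Relation.Unary.All as All using (All)
open import Data.List.Relation.Unary.Unique.Propositional using (Unique)
import Data.List.Relation.Unary.Unique.Propositional.Properties as Unique
open import Data.Product using (_,_; proj₁)
open import Function using (_$_; _∘_; mk⇔)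
open import Relation.Nullary using (yes; no; ¬_)
open import Relation.Nullary.Negation using (contradiction)
open import Relation.Unary using (Decidable)
open import Relation.Binary.PropositionalEquality using (refl; sym; trans; cong; cong₂; subst; subst₂; module ≡-Reasoning)

length-filter-≡-via-inverses :
  ∀ {A B : Set} {P : A → Set} {Q : B → Set} (P? : Decidable P) (Q? : Decidable Q)
  {xs : List A} {ys : List B} → Unique xs → Unique ys → (f : A → B) (g : B → A) →
  (∀ {x} → x ∈ xs → P x → f x ∈ ys × Q (f x) × g (f x) ≡ x) →
  (∀ {y} → y ∈ ys → Q y → g y ∈ xs × P (g y) × f (g y) ≡ y) →
  length (filter P? xs) ≡ length (filter Q? ys)
length-filter-≡-via-inverses P? Q? {xs} {ys} xs! ys! f g forth back = begin
  length (filter P? xs)         ≡⟨ sym (length-map f (filter P? xs)) ⟩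
  length (map f (filter P? xs)) ≡⟨ ↭-length (∼bag⇒↭ (unique∧set⇒bag image! (Unique.filter⁺ Q? ys!) (mk⇔ into onto))) ⟩
  length (filter Q? ys)         ∎
  where
  open ≡-Reasoning
  g∘f≡id : All (λ x → g (f x) ≡ x) (filter P? xs)
  g∘f≡id = All.tabulate λ x∈ → let (x∈xs , px) = ∈-filter⁻ P? x∈ ; (_ , _ , gfx≡x) = forth x∈xs px in gfx≡x
  g∘f-fixes : map g (map f (filter P? xs)) ≡ filter P? xs
  g∘f-fixes = trans (sym (map-∘ (filter P? xs))) (map-id-local g∘f≡id)
  image! : Unique (map f (filter P? xs))
  image! = Unique.map⁻ {f = g} (subst Unique (sym g∘f-fixes) (Unique.filter⁺ P? xs!))
  into : ∀ {z} → z ∈ map f (filter P? xs) → z ∈ filter Q? ys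
  into z∈ with _ , x∈ , refl ← ∈-map⁻ f z∈ with x∈xs , px ← ∈-filter⁻ P? x∈ with fx∈ys , qfx , _ ← forth x∈xs px
    = ∈-filter⁺ Q? fx∈ys qfx
  onto : ∀ {y} → y ∈ filter Q? ys → y ∈ map f (filter P? xs)
  onto y∈ with y∈ys , qy ← ∈-filter⁻ Q? y∈ with gy∈xs , pgy , fgy≡y ← back y∈ys qy
    = subst (_∈ _) fgy≡y (∈-map⁺ f (∈-filter⁺ P? gy∈xs pgy))

∈-range1⁺ : ∀ {n B} → 1 ≤ n → n ≤ B → n ∈ range1 B
∈-range1⁺ {suc n} _ n<B = ∈-map⁺ suc (∈-upTo⁺ n<B)

∈-range1⁻ : ∀ {n B} → n ∈ range1 B → ∃[ k ] n ≡ suc k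
∈-range1⁻ n∈ with k , _ , n≡1+k ← ∈-map⁻ suc n∈ = k , n≡1+k

range1-unique : ∀ B → Unique (range1 B)
range1-unique B = Unique.map⁺ suc-injective (Unique.upTo⁺ B)

record Triple : Set where
  constructor ⟨_,_,_⟩
  field
    left mid right : ℕ
open Triple

record Unimodular (t : Triple) : Set where
  constructor unimodular
  field
    det : left t * right t ≡ mid t * mid t + 1

swap : Triple → Triple
swap ⟨ a , s , b ⟩ = ⟨ b , s , a ⟩

Unimodular-swap : ∀ {t} → Unimodular t → Unimodular (swap t)
Unimodular-swap {⟨ a , s , b ⟩} (unimodular ab≡s²+1) = unimodular (trans (*-comm b a) ab≡s²+1)

left-positive : ∀ {t} → Unimodular t → 1 ≤ left t
left-positive {⟨ zero , s , b ⟩} (unimodular 0≡s²+1) = contradiction (trans 0≡s²+1 (+-comm (s * s) 1)) λ ()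
left-positive {⟨ suc a , s , b ⟩} _ = s≤s z≤n

right-positive : ∀ {t} → Unimodular t → 1 ≤ right t
right-positive u = left-positive (Unimodular-swap u)

root : Triple
root = ⟨ 1 , 0 , 1 ⟩

child₀ : Triple → Triple
child₀ ⟨ a , s , b ⟩ = ⟨ a , a + s , b + (s + (a + s)) ⟩

child₁ : Triple → Triple
child₁ t = swap (child₀ (swap t))

parent₀ : Triple → Triple
parent₀ ⟨ a , s , b ⟩ = ⟨ a , s ∸ a , b ∸ (s ∸ a + s) ⟩

parent₁ : Triple → Triple
parent₁ t = swap (parent₀ (swap t))

Unimodular-child₀ : ∀ {t} → Unimodular t → Unimodular (child₀ t)
Unimodular-child₀ {⟨ a , s , b ⟩} (unimodular ab≡s²+1) = unimodular $ begin
  a * (b + (s + (a + s)))              ≡⟨ *-distribˡ-+ a b _ ⟩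
  a * b + a * (s + (a + s))            ≡⟨ cong (_+ a * (s + (a + s))) ab≡s²+1 ⟩
  s * s + 1 + a * (s + (a + s))        ≡⟨ square-of-sum s a ⟩
  (a + s) * (a + s) + 1                ∎
  where
  open ≡-Reasoning
  square-of-sum : ∀ s a → s * s + 1 + a * (s + (a + s)) ≡ (a + s) * (a + s) + 1
  square-of-sum = solve-∀

Unimodular-child₁ : ∀ {t} → Unimodular t → Unimodular (child₁ t)
Unimodular-child₁ u = Unimodular-swap (Unimodular-child₀ (Unimodular-swap u))

mid<mid-child₀ : ∀ {t} → Unimodular t → mid t < mid (child₀ t)
mid<mid-child₀ {⟨ a , s , b ⟩} u = +-monoˡ-≤ s (left-positive u)

mid<mid-child₁ : ∀ {t} → Unimodular t → mid t < mid (child₁ t)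
mid<mid-child₁ u = mid<mid-child₀ (Unimodular-swap u)

parent₀-child₀ : ∀ t → parent₀ (child₀ t) ≡ t
parent₀-child₀ ⟨ a , s , b ⟩ rewrite m+n∸m≡n a s = cong ⟨ a , s ,_⟩ (m+n∸n≡m b (s + (a + s)))

parent₁-child₁ : ∀ t → parent₁ (child₁ t) ≡ t
parent₁-child₁ t = cong swap (parent₀-child₀ (swap t))

-- With s = a + c, the child's right entry is forced: b ≥ c + s, since otherwise a b ≤ a (c + s) < s² + 1.
child₀-surjective : ∀ {a s b} → Unimodular ⟨ a , s , b ⟩ → a ≤ s → ∃[ t ] Unimodular t × child₀ t ≡ ⟨ a , s , b ⟩
child₀-surjective {a} {s} {b} (unimodular ab≡s²+1) a≤s with c , refl ← m≤n⇒∃[o]m+o≡n a≤s =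
  ⟨ a , c , e ⟩ , unimodular ae≡c²+1 , cong ⟨ a , a + c ,_⟩ e+d≡b
  where
  open ≡-Reasoning
  d = c + (a + c)
  d≤b : d ≤ b
  d≤b with d ≤? b
  ... | yes d≤b = d≤b
  ... | no d≰b = contradiction (subst (_≤ a * d) a[1+b]≡ad+1+n (*-monoʳ-≤ a (≰⇒> d≰b))) (m+1+n≰m (a * d))
    where
    rearrange : ∀ a c → a + ((a + c) * (a + c) + 1) ≡ a * (c + (a + c)) + suc (a + c * c)
    rearrange = solve-∀
    a[1+b]≡ad+1+n : a * suc b ≡ a * d + suc (a + c * c)
    a[1+b]≡ad+1+n = trans (*-suc a b) (trans (cong (_+_ a) ab≡s²+1) (rearrange a c))
  e = b ∸ d
  e+d≡b : e + d ≡ b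
  e+d≡b = m∸n+n≡m d≤b
  ae≡c²+1 : a * e ≡ c * c + 1
  ae≡c²+1 = +-cancelʳ-≡ (a * d) (a * e) (c * c + 1) (begin
    a * e + a * d           ≡⟨ *-distribˡ-+ a e d ⟨
    a * (e + d)             ≡⟨ cong (a *_) e+d≡b ⟩
    a * b                   ≡⟨ ab≡s²+1 ⟩
    (a + c) * (a + c) + 1   ≡⟨ square-of-sum c a ⟩
    c * c + 1 + a * d       ∎)
    where
    square-of-sum : ∀ c a → (a + c) * (a + c) + 1 ≡ c * c + 1 + a * (c + (a + c))
    square-of-sum = solve-∀

child₁-surjective : ∀ {a s b} → Unimodular ⟨ a , s , b ⟩ → b ≤ s → ∃[ t ] Unimodular t × child₁ t ≡ ⟨ a , s , b ⟩
child₁-surjective u b≤s with t , ut , child₀t≡ ← child₀-surjective (Unimodular-swap u) b≤s =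
  swap t , Unimodular-swap ut , cong swap child₀t≡

root-unique : ∀ {t} → Unimodular t → mid t ≡ 0 → t ≡ root
root-unique {⟨ a , zero , b ⟩} (unimodular ab≡1) refl
  rewrite m*n≡1⇒m≡1 a b ab≡1 | m*n≡1⇒n≡1 a b ab≡1 = refl

-- a, b > s ≥ 1 would give a b ≥ (s + 1)² > s² + 1.
right≤mid : ∀ {t} → Unimodular t → 1 ≤ mid t → ¬ left t ≤ mid t → right t ≤ mid t
right≤mid {⟨ a , suc s , b ⟩} (unimodular ab≡s²+1) _ a≰s with b ≤? suc s
... | yes b≤s = b≤s
... | no b≰s = contradiction (subst₂ _≤_ (square-suc s) ab≡s²+1 (*-mono-≤ (≰⇒> a≰s) (≰⇒> b≰s))) (m+1+n≰m _)
  where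
  square-suc : ∀ s → suc (suc s) * suc (suc s) ≡ (suc s * suc s + 1) + suc (s + suc s)
  square-suc = solve-∀

Path : Set
Path = List Bool

child : Bool → Triple → Triple
child false = child₀
child true = child₁

parent : Bool → Triple → Triple
parent false = parent₀
parent true = parent₁

parent-child : ∀ b t → parent b (child b t) ≡ t
parent-child false = parent₀-child₀
parent-child true = parent₁-child₁

triple : Path → Triple
triple [] = root
triple (b ∷ p) = child b (triple p)

Unimodular-child : ∀ b {t} → Unimodular t → Unimodular (child b t)
Unimodular-child false = Unimodular-child₀
Unimodular-child true = Unimodular-child₁

mid<mid-child : ∀ b {t} → Unimodular t → mid t < mid (child b t)
mid<mid-child false = mid<mid-child₀
mid<mid-child true = mid<mid-child₁

Unimodular-triple : ∀ p → Unimodular (triple p)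
Unimodular-triple [] = unimodular refl
Unimodular-triple (b ∷ p) = Unimodular-child b (Unimodular-triple p)

length≤mid-triple : ∀ p → length p ≤ mid (triple p)
length≤mid-triple [] = z≤n
length≤mid-triple (b ∷ p) = ≤-trans (s≤s (length≤mid-triple p)) (mid<mid-child b (Unimodular-triple p))

descend : ℕ → Triple → Path
descend zero t = []
descend (suc f) t with mid t ≟ 0 | left t ≤? mid t
... | yes _ | _ = []
... | no _ | yes _ = false ∷ descend f (parent₀ t)
... | no _ | no _ = true ∷ descend f (parent₁ t)

descend-child : ∀ b f {t} → Unimodular t → descend (suc f) (child b t) ≡ b ∷ descend f t
descend-child false f {t} u with mid (child₀ t) ≟ 0 | left (child₀ t) ≤? mid (child₀ t)
... | yes mid≡0 | _ = contradiction mid≡0 (m<n⇒n≢0 (mid<mid-child₀ u))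
... | no _ | no a≰a+s = contradiction (m≤m+n (left t) (mid t)) a≰a+s
... | no _ | yes _ = cong (false ∷_) (cong (descend f) (parent₀-child₀ t))
descend-child true f {t} u with mid (child₁ t) ≟ 0 | left (child₁ t) ≤? mid (child₁ t)
... | yes mid≡0 | _ = contradiction mid≡0 (m<n⇒n≢0 (mid<mid-child₁ u))
... | no _ | yes a′≤b+s = contradiction a′≤b+s (<⇒≱ b+s<a′)
  where
  b+s<a′ : right t + mid t < left (child₁ t)
  b+s<a′ = ≤-trans (s≤s (m≤n+m _ (mid t))) (+-monoˡ-≤ _ (left-positive u))
... | no _ | no _ = cong (true ∷_) (cong (descend f) (parent₁-child₁ t))

descend-triple : ∀ p {f} → length p ≤ f → descend f (triple p) ≡ p
descend-triple [] {zero} _ = refl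
descend-triple [] {suc f} _ = refl
descend-triple (b ∷ p) {suc f} (s≤s |p|≤f) =
  trans (descend-child b f (Unimodular-triple p)) (cong (b ∷_) (descend-triple p |p|≤f))

triple-descend-child : ∀ b {f t} → (∀ {t′} → Unimodular t′ → mid t′ ≤ f → triple (descend f t′) ≡ t′) →
  mid t ≤ suc f → ∃[ t′ ] Unimodular t′ × child b t′ ≡ t → triple (b ∷ descend f (parent b t)) ≡ t
triple-descend-child b {f} triple-descend-f s≤1+f (t′ , u′ , refl) =
  cong (child b) (trans (cong (triple ∘ descend f) (parent-child b t′))
                        (triple-descend-f u′ (≤-pred (≤-trans (mid<mid-child b u′) s≤1+f))))

triple-descend : ∀ f {t} → Unimodular t → mid t ≤ f → triple (descend f t) ≡ t
triple-descend zero u s≤0 = sym (root-unique u (n≤0⇒n≡0 s≤0))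
triple-descend (suc f) {t} u s≤1+f with mid t ≟ 0 | left t ≤? mid t
... | yes s≡0 | _ = sym (root-unique u s≡0)
... | no s≢0 | yes a≤s = triple-descend-child false (triple-descend f) s≤1+f (child₀-surjective u a≤s)
... | no s≢0 | no a≰s = triple-descend-child true (triple-descend f) s≤1+f
                           (child₁-surjective u (right≤mid u (n≢0⇒n>0 s≢0) a≰s))

-- A path spells the binary digits of its index below the leading 1, least significant first.
index : Path → ℕ
index [] = 1
index (false ∷ p) = 2 * index p
index (true ∷ p) = suc (2 * index p)

index-positive : ∀ p → 1 ≤ index p
index-positive [] = ≤-refl
index-positive (false ∷ p) = ≤-trans (index-positive p) (m≤m+n (index p) _)
index-positive (true ∷ p) = s≤s z≤n

index-injective : ∀ p q → index p ≡ index q → p ≡ q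
index-injective [] [] _ = refl
index-injective [] (false ∷ q) 1≡2k = contradiction (sym 1≡2k) (even≢odd (index q) 0)
index-injective [] (true ∷ q) 1≡2k+1 = contradiction (suc-injective (sym 1≡2k+1)) (m<n⇒n≢0 (*-monoʳ-≤ 2 (index-positive q)))
index-injective (false ∷ p) [] 2k≡1 = contradiction 2k≡1 (even≢odd (index p) 0)
index-injective (true ∷ p) [] 2k+1≡1 = contradiction (suc-injective 2k+1≡1) (m<n⇒n≢0 (*-monoʳ-≤ 2 (index-positive p)))
index-injective (false ∷ p) (false ∷ q) eq = cong (false ∷_) (index-injective p q (*-cancelˡ-≡ _ _ 2 eq))
index-injective (true ∷ p) (true ∷ q) eq = cong (true ∷_) (index-injective p q (*-cancelˡ-≡ _ _ 2 (suc-injective eq)))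
index-injective (false ∷ p) (true ∷ q) eq = contradiction eq (even≢odd (index p) (index q))
index-injective (true ∷ p) (false ∷ q) eq = contradiction (sym eq) (even≢odd (index q) (index p))

index<2^1+length : ∀ p → index p < 2 ^ suc (length p)
index<2^1+length [] = ≤-refl
index<2^1+length (b ∷ p) = ≤-<-trans (index-∷≤ b)
  (subst (_≤ 2 * 2 ^ suc (length p)) (*-distribˡ-+ 2 1 (index p)) (*-monoʳ-≤ 2 (index<2^1+length p)))
  where
  index-∷≤ : ∀ b → index (b ∷ p) ≤ suc (2 * index p)
  index-∷≤ false = n≤1+n _
  index-∷≤ true = ≤-refl

successor : Path → Path
successor [] = false ∷ []
successor (false ∷ p) = true ∷ p
successor (true ∷ p) = false ∷ successor p

index-successor : ∀ p → index (successor p) ≡ suc (index p)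
index-successor [] = refl
index-successor (false ∷ p) = refl
index-successor (true ∷ p) = trans (cong (2 *_) (index-successor p)) (*-distribˡ-+ 2 1 (index p))

pathTo : ℕ → Path
pathTo zero = []
pathTo (suc n) = successor (pathTo n)

index-pathTo : ∀ n → index (pathTo n) ≡ suc n
index-pathTo zero = refl
index-pathTo (suc n) = trans (index-successor (pathTo n)) (cong suc (index-pathTo n))

twice-plus : ∀ u v {w} → 2 * u + v ≡ w → + 2 ℤ.* + u ℤ.+ + v ≡ + w
twice-plus u v refl = trans (cong (ℤ._+ + v) (sym (ℤ.pos-* 2 u))) (sym (ℤ.pos-+ (2 * u) v))

twice-minus : ∀ u v {w} → 2 * u ≡ w + v → + 2 ℤ.* + u ℤ.+ ℤ.- + v ≡ + w
twice-minus u v {w} 2u≡w+v = begin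
  + 2 ℤ.* + u ℤ.- + v     ≡⟨ cong (ℤ._- + v) (sym (ℤ.pos-* 2 u)) ⟩
  + (2 * u) ℤ.- + v       ≡⟨ ℤ.m-n≡m⊖n (2 * u) v ⟩
  (2 * u) ℤ.⊖ v           ≡⟨ ℤ.⊖-≥ (subst (v ≤_) (sym 2u≡w+v) (m≤n+m v w)) ⟩
  + (2 * u ∸ v)           ≡⟨ cong (λ n → + (n ∸ v)) 2u≡w+v ⟩
  + (w + v ∸ v)           ≡⟨ cong +_ (m+n∸n≡m w v) ⟩
  + w                     ∎
  where open ≡-Reasoning

module _ (s : ℕ → ℤ) where

  recurrence-plus : ∀ {n i j u v w} → s n ≡ + 2 ℤ.* s i ℤ.+ s j → s i ≡ + u → s j ≡ + v → 2 * u + v ≡ w → s n ≡ + w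
  recurrence-plus {u = u} {v} sₙ≡ sᵢ≡u sⱼ≡v 2u+v≡w =
    trans sₙ≡ (trans (cong₂ (λ x y → + 2 ℤ.* x ℤ.+ y) sᵢ≡u sⱼ≡v) (twice-plus u v 2u+v≡w))

  recurrence-minus : ∀ {n i j u v w} → s n ≡ + 2 ℤ.* s i ℤ.+ ℤ.- s j → s i ≡ + u → s j ≡ + v → 2 * u ≡ w + v → s n ≡ + w
  recurrence-minus {u = u} {v} sₙ≡ sᵢ≡u sⱼ≡v 2u≡w+v =
    trans sₙ≡ (trans (cong₂ (λ x y → + 2 ℤ.* x ℤ.- y) sᵢ≡u sⱼ≡v) (twice-minus u v 2u≡w+v))

module _ {s : ℕ → ℤ} (S : IsS s) where
  open IsS S

  Agrees : Path → Set
  Agrees p = s (index p) ≡ + mid (triple p)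

  agrees-grandchildren : ∀ p → Agrees p → Agrees (false ∷ p) → Agrees (true ∷ p) → ∀ b c → Agrees (c ∷ b ∷ p)
  agrees-grandchildren p sₖ s₂ₖ s₂ₖ₊₁′ = grandchild
    where
    k = index p
    k≥1 = index-positive p
    a = left (triple p)
    x = mid (triple p)
    b = right (triple p)
    s₂ₖ₊₁ : s (2 * k + 1) ≡ + (b + x)
    s₂ₖ₊₁ = trans (cong s (+-comm (2 * k) 1)) s₂ₖ₊₁′
    4k : ∀ k → 2 * (2 * k) ≡ 4 * k
    4k = solve-∀
    4k+1 : ∀ k → suc (2 * (2 * k)) ≡ 4 * k + 1
    4k+1 = solve-∀
    4k+2 : ∀ k → 2 * suc (2 * k) ≡ 4 * k + 2
    4k+2 = solve-∀
    4k+3 : ∀ k → suc (2 * suc (2 * k)) ≡ 4 * k + 3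
    4k+3 = solve-∀
    same-side : ∀ a x → 2 * (a + x) ≡ a + (a + x) + x
    same-side = solve-∀
    opposite-side : ∀ a x b → 2 * (a + x) + (b + x) ≡ b + (x + (a + x)) + (a + x)
    opposite-side = solve-∀
    grandchild : ∀ b c → Agrees (c ∷ b ∷ p)
    grandchild false false = recurrence-minus s (trans (cong s (4k k)) (s4k k k≥1)) s₂ₖ sₖ (same-side a x)
    grandchild false true = recurrence-plus s (trans (cong s (4k+1 k)) (s4k+1 k k≥1)) s₂ₖ s₂ₖ₊₁ (opposite-side a x b)
    grandchild true false = recurrence-plus s (trans (cong s (4k+2 k)) (s4k+2 k k≥1)) s₂ₖ₊₁ s₂ₖ (opposite-side b x a)
    grandchild true true = recurrence-minus s (trans (cong s (4k+3 k)) (s4k+3 k k≥1)) s₂ₖ₊₁ sₖ (same-side b x)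

  agrees-with-children : ∀ p → Agrees p × Agrees (false ∷ p) × Agrees (true ∷ p)
  agrees-with-children [] = s1 , s2 , s3
  agrees-with-children (b ∷ p) with agrees-with-children p
  ... | sₖ , s₂ₖ , s₂ₖ₊₁ = agrees-child b , agrees-grandchildren p sₖ s₂ₖ s₂ₖ₊₁ b false , agrees-grandchildren p sₖ s₂ₖ s₂ₖ₊₁ b true
    where
    agrees-child : ∀ b → Agrees (b ∷ p)
    agrees-child false = s₂ₖ
    agrees-child true = s₂ₖ₊₁

  s-index : ∀ p → s (index p) ≡ + mid (triple p)
  s-index p = proj₁ (agrees-with-children p)

pathTo-index : ∀ p → pathTo (pred (index p)) ≡ p
pathTo-index p = index-injective _ p (trans (index-pathTo (pred (index p))) (suc-pred (index p) {{>-nonZero (index-positive p)}}))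

index≤2^1+mid : ∀ p → index p ≤ 2 ^ suc (mid (triple p))
index≤2^1+mid p = <⇒≤ (<-≤-trans (index<2^1+length p) (^-monoʳ-≤ 2 (s≤s (length≤mid-triple p))))

left∣mid²+1 : ∀ {t} → Unimodular t → left t ∣ mid t * mid t + 1
left∣mid²+1 {t} (unimodular ab≡s²+1) = divides (right t) (trans (sym ab≡s²+1) (*-comm (left t) (right t)))

left≤mid²+1 : ∀ {t} → Unimodular t → left t ≤ mid t * mid t + 1
left≤mid²+1 {t} u@(unimodular ab≡s²+1) = subst (left t ≤_) ab≡s²+1 (m≤m*n (left t) (right t) {{>-nonZero (right-positive u)}})

module _ (m : ℕ) where

  leftOfNode : ℕ → ℕ
  leftOfNode n = left (triple (pathTo (pred n)))

  cofactor : ℕ → ℕ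
  cofactor zero = zero
  cofactor (suc d) = (m * m + 1) / suc d

  cofactor-left : ∀ {t} → Unimodular t → mid t ≡ m → cofactor (left t) ≡ right t
  cofactor-left {⟨ zero , _ , _ ⟩} u _ = contradiction (left-positive u) λ ()
  cofactor-left {⟨ suc a , _ , b ⟩} (unimodular ab≡m²+1) refl =
    trans (cong (_/ suc a) (trans (sym ab≡m²+1) (*-comm (suc a) b))) (m*n/n≡m b (suc a))

  Unimodular-cofactor : ∀ {d} → d ∣ m * m + 1 → 1 ≤ d → Unimodular ⟨ d , m , cofactor d ⟩
  Unimodular-cofactor {suc d} (divides q N≡q[1+d]) _ = unimodular $ begin
    suc d * ((m * m + 1) / suc d)  ≡⟨ cong (λ n → suc d * (n / suc d)) N≡q[1+d] ⟩
    suc d * (q * suc d / suc d)    ≡⟨ cong (suc d *_) (m*n/n≡m q (suc d)) ⟩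
    suc d * q                      ≡⟨ *-comm (suc d) q ⟩
    q * suc d                      ≡⟨ N≡q[1+d] ⟨
    m * m + 1                      ∎
    where open ≡-Reasoning

  left-divisor : ∀ {t} → Unimodular t → mid t ≡ m → left t ∈ range1 (m * m + 1) × left t ∣ m * m + 1
  left-divisor u refl = ∈-range1⁺ (left-positive u) (left≤mid²+1 u) , left∣mid²+1 u

  divisorNode : ℕ → Path
  divisorNode d = descend m ⟨ d , m , cofactor d ⟩

  triple-divisorNode : ∀ {d} → d ∣ m * m + 1 → 1 ≤ d → triple (divisorNode d) ≡ ⟨ d , m , cofactor d ⟩
  triple-divisorNode d∣N d≥1 = triple-descend m (Unimodular-cofactor d∣N d≥1) ≤-refl

  divisorNode-left : ∀ p → mid (triple p) ≡ m → divisorNode (left (triple p)) ≡ p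
  divisorNode-left p mid≡m = trans (cong (descend m) divisor-triple) (descend-triple p (subst (length p ≤_) mid≡m (length≤mid-triple p)))
    where
    divisor-triple : ⟨ left (triple p) , m , cofactor (left (triple p)) ⟩ ≡ triple p
    divisor-triple = cong₂ ⟨ left (triple p) ,_,_⟩ (sym mid≡m) (cofactor-left (Unimodular-triple p) mid≡m)

module _ {s : ℕ → ℤ} (S : IsS s) (m : ℕ) where

  mid-pathTo : ∀ n → s (suc n) ≡ + m → mid (triple (pathTo n)) ≡ m
  mid-pathTo n s[1+n]≡m = ℤ.+-injective (trans (sym (s-index S (pathTo n))) (trans (cong s (index-pathTo n)) s[1+n]≡m))

  value-bound : ∀ n → 1 ≤ n → s n ≡ + m → n ≤ 2 ^ suc m
  value-bound (suc n) _ s[1+n]≡m =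
    subst₂ _≤_ (index-pathTo n) (cong (λ x → 2 ^ suc x) (mid-pathTo n s[1+n]≡m)) (index≤2^1+mid (pathTo n))

  node⇒divisor : ∀ {n} → n ∈ range1 (2 ^ suc m) → s n ≡ + m →
    leftOfNode m n ∈ range1 (m * m + 1) × leftOfNode m n ∣ m * m + 1 × index (divisorNode m (leftOfNode m n)) ≡ n
  node⇒divisor n∈ sₙ≡m with k , refl ← ∈-range1⁻ n∈ =
    let a∈ , a∣ = left-divisor m (Unimodular-triple (pathTo k)) (mid-pathTo k sₙ≡m) in
    a∈ , a∣ , trans (cong index (divisorNode-left m (pathTo k) (mid-pathTo k sₙ≡m))) (index-pathTo k)

  divisor⇒node : ∀ {d} → d ∈ range1 (m * m + 1) → d ∣ m * m + 1 →
    index (divisorNode m d) ∈ range1 (2 ^ suc m) × s (index (divisorNode m d)) ≡ + m × leftOfNode m (index (divisorNode m d)) ≡ d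
  divisor⇒node {d} d∈ d∣N with k , refl ← ∈-range1⁻ d∈ =
    ∈-range1⁺ (index-positive p) (subst (λ x → index p ≤ 2 ^ suc x) (cong mid p↦d) (index≤2^1+mid p)) ,
    trans (s-index S p) (cong (λ t → + mid t) p↦d) ,
    trans (cong (left ∘ triple) (pathTo-index p)) (cong left p↦d)
    where
    p = divisorNode m d
    p↦d = triple-divisorNode m d∣N (s≤s z≤n)

theorem4 : (s : ℕ → ℤ) → IsS s → (m : ℕ) →
    ∃[ B ] ((∀ n → 1 ≤ n → s n ≡ + m → n ≤ B) ×
    length (filter (λ n → s n ℤ.≟ + m) (range1 B)) ≡ τ (m * m + 1))
theorem4 s S m =
  2 ^ suc m , value-bound S m ,
  length-filter-≡-via-inverses (λ n → s n ℤ.≟ + m) (_∣? m * m + 1) (range1-unique _) (range1-unique _)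
    (leftOfNode m) (index ∘ divisorNode m) (node⇒divisor S m) (divisor⇒node S m)
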